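{- For every odd integer $n\ge 7$, $\mathsf{norm}(\Xi_n)\ne M^{\mathrm{kir}}_n$.
   Context: For an integer $n\ge 1$, $K^\bullet_n$ denotes the complete graph on vertex set $\{0,1,\ldots,n-1\}$ whose edges are colored by the circular-distance edge coloring: the edge $\{i,j\}$ receives color $c_{\min\{|i-j|,\,n-|i-j|\}}$, where $c_1,c_2,\ldots$ are distinct colors. An RPM is a rainbow matching (pairwise vertex-disjoint edges with pairwise distinct colors) with $\lfloor n/2\rfloor$ edges. Operations on a matching $M$ in $K^\bullet_n$: $\mathrm{rot}(M,\alpha)=\{\{(i+\alpha)\bmod n,(j+\alpha)\bmod n\}:\{i,j\}\in M\}$ for $\alpha\in\mathbb Z$, and $\mathrm{rev}(M)=\{\{n-1-i,n-1-j\}:\{i,j\}\in M\}$. The normalization $\mathsf{norm}(M)$ of an RPM $M$ is computed as follows: let $\{i,j\}$ with $i<j$ be the edge of $M$ of color $c_1$; if $\{i,j\}\ne\{0,n-1\}$, replace $M$ by $\mathrm{rot}(M,-j)$. Then for $k=2,3,\ldots,\lfloor n/2\rfloor$ in order: let $\{i,j\}$ be the edge of (the current) $M$ of color $c_k$; if $i+j<n-1$, output $M$ and stop; if $i+j>n-1$, output $\mathrm{rev}(M)$ and stop. If the loop finishes without stopping, output $M$. The Kirkman matching is $M^{\mathrm{kir}}_n=\{\{i,n-1-i\}: i=0,1,\ldots,\lfloor n/2\rfloor-1\}$. The ARS matching $\Xi_n$, for odd $n\ge 1$, is defined recursively by $\Xi_n=\Xi'_n\cup\Xi''_n\cup\Xi'''_n$,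 where $\Xi'_1=\Xi''_1=\Xi'''_1=\emptyset$, and for $n\ge 3$ write $n=8k+r$ with $k\ge 0$ an integer and $r\in\{1,3,5,7\}$; then: $\Xi'_n=\{\{i,2k-1-i\}: i=0,\ldots,k-1\}$ if $r\in\{1,3\}$, and $\Xi'_n=\{\{i,2k+1-i\}: i=0,\ldots,k\}$ if $r\in\{5,7\}$; $\Xi''_n=\{\{2k+i,4k+1+2i\}: i=0,\ldots,2k-1\}$ if $r=1$; $\{\{2k+i,4k+1+2i\}: i=0,\ldots,2k\}$ if $r=3$; $\{\{2k+2+i,4k+4+2i\}: i=0,\ldots,2k\}$ if $r=5$; $\{\{2k+2+i,4k+4+2i\}: i=0,\ldots,2k+1\}$ if $r=7$; $\Xi'''_n=\{\{s+2i,\,s+2j\}: \{i,j\}\in \Xi_{2k+1}\}$ where $s=4k$ if $r=1$, $s=4k+2$ if $r=3$, $s=4k+3$ if $r=5$, $s=4k+5$ if $r=7$. (Index ranges with upper bound below the lower bound give the empty set.) For odd $n$, $\Xi_n$ is an RPM in $K^\bullet_n$. -}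

module Defs where

open import Data.Nat using (ℕ; zero; suc; _+_; _*_; _∸_; _≡ᵇ_; _<ᵇ_; _⊓_; _⊔_; ∣_-_∣; _/_; _%_)
open import Data.List using (List; []; _∷_; map; upTo; _++_)
open import Data.Product using (_×_; _,_)
open import Data.Maybe using (Maybe; just; nothing)
open import Data.Bool using (Bool; true; false; if_then_else_; _∧_)
open import Data.List.Membership.Propositional using (_∈_)
open import Function.Bundles using (_⇔_)

-- An (unordered) edge {i,j} is stored as the ordered pair (min i j , max i j).
Edge : Set
Edge = ℕ × ℕ

mkEdge : ℕ → ℕ → Edge
mkEdge i j = (i ⊓ j , i ⊔ j)

-- A matching is a finite list of edges (read as the set of its elements).
Matching : Set
Matching = List Edge

-- the index d of the colour c_d of edge {i,j} in K•_n (circular distance)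
colour : ℕ → ℕ → ℕ → ℕ
colour n i j = ∣ i - j ∣ ⊓ (n ∸ ∣ i - j ∣)

-- rot(M, a) for a natural shift a  (rot(M,-j) = rot(M, n-j) for 0 ≤ j ≤ n)
rot : ℕ → Matching → ℕ → Matching
rot zero    M a = M
rot (suc m) M a = map (λ { (i , j) → mkEdge ((i + a) % suc m) ((j + a) % suc m) }) M

rev : ℕ → Matching → Matching
rev n M = map (λ { (i , j) → mkEdge (n ∸ 1 ∸ i) (n ∸ 1 ∸ j) }) M

findColour : ℕ → ℕ → Matching → Maybe Edge
findColour n c [] = nothing
findColour n c ((i , j) ∷ es) = if colour n i j ≡ᵇ c then just (i , j) else findColour n c es

normLoop : ℕ → ℕ → ℕ → Matching → Matching
normLoop n k zero M = M
normLoop n k (suc cnt) M with findColour n k M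
... | nothing = normLoop n (suc k) cnt M
... | just (i , j) =
  if (i + j) <ᵇ (n ∸ 1) then M
  else if (n ∸ 1) <ᵇ (i + j) then rev n M
  else normLoop n (suc k) cnt M

-- first step: rotate so that the c_1 edge becomes {0, n-1}
normStep1 : ℕ → Matching → Matching
normStep1 n M with findColour n 1 M
... | nothing = M
... | just (i , j) = if (i ≡ᵇ 0) ∧ (j ≡ᵇ (n ∸ 1)) then M else rot n M (n ∸ j)

norm : ℕ → Matching → Matching
norm n M = normLoop n 2 ((n / 2) ∸ 1) (normStep1 n M)

kirkman : ℕ → Matching
kirkman n = map (λ i → mkEdge i (n ∸ 1 ∸ i)) (upTo (n / 2))

Xi′ : ℕ → ℕ → Matching
Xi′ k r with r
... | 1 = map (λ i → mkEdge i (2 * k ∸ 1 ∸ i)) (upTo k)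
... | 3 = map (λ i → mkEdge i (2 * k ∸ 1 ∸ i)) (upTo k)
... | 5 = map (λ i → mkEdge i (2 * k + 1 ∸ i)) (upTo (k + 1))
... | 7 = map (λ i → mkEdge i (2 * k + 1 ∸ i)) (upTo (k + 1))
... | _ = []

Xi″ : ℕ → ℕ → Matching
Xi″ k r with r
... | 1 = map (λ i → mkEdge (2 * k + i) (4 * k + 1 + 2 * i)) (upTo (2 * k))
... | 3 = map (λ i → mkEdge (2 * k + i) (4 * k + 1 + 2 * i)) (upTo (2 * k + 1))
... | 5 = map (λ i → mkEdge (2 * k + 2 + i) (4 * k + 4 + 2 * i)) (upTo (2 * k + 1))
... | 7 = map (λ i → mkEdge (2 * k + 2 + i) (4 * k + 4 + 2 * i)) (upTo (2 * k + 2))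
... | _ = []

shiftS : ℕ → ℕ → ℕ
shiftS k r with r
... | 1 = 4 * k
... | 3 = 4 * k + 2
... | 5 = 4 * k + 3
... | 7 = 4 * k + 5
... | _ = 0

XiFuel : ℕ → ℕ → Matching
XiFuel zero n = []
XiFuel (suc f) 0 = []
XiFuel (suc f) 1 = []
XiFuel (suc f) n@(suc (suc _)) =
  Xi′ (n / 8) (n % 8) ++ Xi″ (n / 8) (n % 8) ++
  map (λ { (i , j) → mkEdge (shiftS (n / 8) (n % 8) + 2 * i) (shiftS (n / 8) (n % 8) + 2 * j) })
      (XiFuel f (2 * (n / 8) + 1))

-- Ξ_n (meaningful for odd n); each recursive call strictly decreases n, so fuel n suffices
Xi : ℕ → Matching
Xi n = XiFuel n n

SameMatching : Matching → Matching → Set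
SameMatching M N = ∀ (e : Edge) → (e ∈ M) ⇔ (e ∈ N)

{-# OPTIONS --safe #-}
-- The vertex sum i + j of an edge behaves well under the normalisation: a rotation by t adds
-- 2t to every sum modulo n, and the reversal replaces every sum s by 2(n - 1) - s. Hence
-- "M contains two edges whose sums differ by d modulo n" survives the normalisation (with the
-- two edges swapped under reversal). The two first edges of Ξ''_n have sums differing by
-- exactly 3, whereas all edges of the Kirkman matching have sum n - 1, so for n > 3 the
-- normalisation of Ξ_n cannot be the Kirkman matching.
module Submission where

open import Defs
open import Data.Nat using (ℕ; _≤_; _%_)
open import Relation.Binary.PropositionalEquality using (_≡_)
open import Relation.Nullary using (¬_)

open import Data.Bool using (true; false; _∧_)
open import Data.List using ([]; _∷_; map; upTo)
open import Data.List.Membership.Propositional using (_∈_)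
open import Data.List.Membership.Propositional.Properties using (∈-map⁺; ∈-map⁻; ∈-++⁺ˡ; ∈-++⁺ʳ; ∈-upTo⁺; ∈-upTo⁻)
open import Data.List.Relation.Binary.Subset.Propositional using (_⊆_)
open import Data.Maybe using (just; nothing)
open import Data.Nat using (zero; suc; _+_; _*_; _∸_; _<_; _/_; _⊓_; _⊔_; z≤n; s≤s; s≤s⁻¹; NonZero; _≡ᵇ_; _<ᵇ_)
open import Data.Nat.DivMod using (m≡m%n+[m/n]*n; m%n<n; [m+kn]%n≡m%n; m*n%n≡0; m<n⇒m%n≡m; m/n≤m; m∣n⇒o%n%m≡o%m)
open import Data.Nat.Divisibility using (divides)
open import Data.Nat.Properties
open import Algebra.Properties.CommutativeSemigroup +-commutativeSemigroup using (interchange; xy∙z≈xz∙y; xy∙z≈x∙zy)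
open import Data.Nat.Tactic.RingSolver using (solve-∀; solve)
open import Data.Product using (_×_; _,_; ∃₂)
open import Function.Base using (_∘_)
open import Function.Bundles using (Equivalence)
open import Relation.Binary.PropositionalEquality using (refl; sym; trans; cong; cong₂; subst; subst₂; module ≡-Reasoning)

infix 4 _≡_mod_

_≡_mod_ : ℕ → ℕ → ℕ → Set
_≡_mod_ x y n = ∃₂ λ a b → x + a * n ≡ y + b * n

module _ {n : ℕ} where

  ≡⇒≡-mod : ∀ {x y} → x ≡ y → x ≡ y mod n
  ≡⇒≡-mod refl = 0 , 0 , refl

  ≡-mod-sym : ∀ {x y} → x ≡ y mod n → y ≡ x mod n
  ≡-mod-sym (a , b , eq) = b , a , sym eq

  +-*-distribʳ-assoc : ∀ x a b → x + (a + b) * n ≡ x + a * n + b * n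
  +-*-distribʳ-assoc x a b = trans (cong (x +_) (*-distribʳ-+ n a b)) (sym (+-assoc x (a * n) (b * n)))

  ≡-mod-trans : ∀ {x y z} → x ≡ y mod n → y ≡ z mod n → x ≡ z mod n
  ≡-mod-trans {x} {y} {z} (a , b , p) (c , d , q) = a + c , d + b , (begin
    x + (a + c) * n      ≡⟨ +-*-distribʳ-assoc x a c ⟩
    x + a * n + c * n    ≡⟨ cong (_+ c * n) p ⟩
    y + b * n + c * n    ≡⟨ xy∙z≈xz∙y y (b * n) (c * n) ⟩
    y + c * n + b * n    ≡⟨ cong (_+ b * n) q ⟩
    z + d * n + b * n    ≡⟨ sym (+-*-distribʳ-assoc z d b) ⟩
    z + (d + b) * n      ∎)
    where open ≡-Reasoning

  +-congˡ-mod : ∀ c {x y} → x ≡ y mod n → c + x ≡ c + y mod n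
  +-congˡ-mod c {x} {y} (a , b , eq) = a , b , (begin
    c + x + a * n    ≡⟨ +-assoc c x (a * n) ⟩
    c + (x + a * n)  ≡⟨ cong (c +_) eq ⟩
    c + (y + b * n)  ≡⟨ sym (+-assoc c y (b * n)) ⟩
    c + y + b * n    ∎)
    where open ≡-Reasoning

  +-congʳ-mod : ∀ c {x y} → x ≡ y mod n → x + c ≡ y + c mod n
  +-congʳ-mod c {x} {y} eq = subst₂ (λ u v → u ≡ v mod n) (+-comm c x) (+-comm c y) (+-congˡ-mod c eq)

  +-cancelʳ-mod : ∀ c {x y} → x + c ≡ y + c mod n → x ≡ y mod n
  +-cancelʳ-mod c {x} {y} (a , b , eq) = a , b , +-cancelʳ-≡ c (x + a * n) (y + b * n) (begin
    x + a * n + c    ≡⟨ xy∙z≈xz∙y x (a * n) c ⟩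
    x + c + a * n    ≡⟨ eq ⟩
    y + c + b * n    ≡⟨ xy∙z≈xz∙y y c (b * n) ⟩
    y + b * n + c    ∎)
    where open ≡-Reasoning

  ≡-mod-reflect : ∀ {x y x′ y′ d c} → x + d ≡ y mod n → x′ + x ≡ c → y′ + y ≡ c → y′ + d ≡ x′ mod n
  ≡-mod-reflect {x} {y} {x′} {y′} {d} gap x′+x≡c y′+y≡c = +-cancelʳ-mod x
    (subst₂ (λ u v → u ≡ v mod n) (sym (xy∙z≈x∙zy y′ d x)) (trans y′+y≡c (sym x′+x≡c)) (+-congˡ-mod y′ gap))

  ≡-mod-0⇒≡0 : .{{_ : NonZero n}} → ∀ {x} → x ≡ 0 mod n → x < n → x ≡ 0
  ≡-mod-0⇒≡0 {x} (a , b , eq) x<n = begin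
    x                ≡⟨ m<n⇒m%n≡m x<n ⟨
    x % n            ≡⟨ [m+kn]%n≡m%n x a n ⟨
    (x + a * n) % n  ≡⟨ cong (_% n) eq ⟩
    (b * n) % n      ≡⟨ m*n%n≡0 b n ⟩
    0                ∎
    where open ≡-Reasoning

edgeSum : Edge → ℕ
edgeSum (i , j) = i + j

edgeSum-mkEdge : ∀ i j → edgeSum (mkEdge i j) ≡ i + j
edgeSum-mkEdge zero    j       = refl
edgeSum-mkEdge (suc i) zero    = sym (+-identityʳ (suc i))
edgeSum-mkEdge (suc i) (suc j) = cong suc (begin
  i ⊓ j + suc (i ⊔ j)    ≡⟨ +-suc (i ⊓ j) (i ⊔ j) ⟩
  suc (i ⊓ j + (i ⊔ j))  ≡⟨ cong suc (edgeSum-mkEdge i j) ⟩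
  suc (i + j)            ≡⟨ +-suc i j ⟨
  i + suc j              ∎)
  where open ≡-Reasoning

EdgeBelow : ℕ → Edge → Set
EdgeBelow n (i , j) = i < n × j < n

mkEdge-below : ∀ {n i j} → i < n → j < n → EdgeBelow n (mkEdge i j)
mkEdge-below {i = i} {j} i<n j<n = ≤-<-trans (m⊓n≤m i j) i<n , ⊔-lub i<n j<n

record SumGap (n d : ℕ) (M : Matching) : Set where
  constructor sumGap
  field
    {e f} : Edge
    e∈M   : e ∈ M
    f∈M   : f ∈ M
    -- needed for the reversal n - 1 - i to be exact under truncated subtraction
    e<n   : EdgeBelow n e
    f<n   : EdgeBelow n f
    gap   : edgeSum e + d ≡ edgeSum f mod n

SumGap-mono : ∀ {n d M N} → M ⊆ N → SumGap n d M → SumGap n d N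
SumGap-mono M⊆N (sumGap e∈M f∈M e<n f<n gap) = sumGap (M⊆N e∈M) (M⊆N f∈M) e<n f<n gap

module _ (m : ℕ) where

  private
    n : ℕ
    n = suc m

  edgeSum-rot : ∀ i j t → edgeSum (mkEdge ((i + t) % n) ((j + t) % n)) ≡ edgeSum (i , j) + (t + t) mod n
  edgeSum-rot i j t = (i + t) / n + (j + t) / n , 0 , (begin
    edgeSum (mkEdge p q) + (P + Q) * n  ≡⟨ cong (_+ (P + Q) * n) (edgeSum-mkEdge p q) ⟩
    p + q + (P + Q) * n                 ≡⟨ cong (p + q +_) (*-distribʳ-+ n P Q) ⟩
    p + q + (P * n + Q * n)             ≡⟨ interchange p q (P * n) (Q * n) ⟩
    (p + P * n) + (q + Q * n)           ≡⟨ cong₂ _+_ (m≡m%n+[m/n]*n (i + t) n) (m≡m%n+[m/n]*n (j + t) n) ⟨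
    (i + t) + (j + t)                   ≡⟨ interchange i t j t ⟩
    i + j + (t + t)                     ≡⟨ +-identityʳ _ ⟨
    i + j + (t + t) + 0                 ∎)
    where
    open ≡-Reasoning
    p = (i + t) % n
    q = (j + t) % n
    P = (i + t) / n
    Q = (j + t) / n

  SumGap-rot : ∀ {d} M t → SumGap n d M → SumGap n d (rot n M t)
  SumGap-rot {d} M t (sumGap {i , j} {i′ , j′} e∈M f∈M _ _ gap) =
    sumGap (∈-map⁺ _ e∈M) (∈-map⁺ _ f∈M)
      (mkEdge-below (m%n<n (i + t) n) (m%n<n (j + t) n)) (mkEdge-below (m%n<n (i′ + t) n) (m%n<n (j′ + t) n))
      (≡-mod-trans (+-congʳ-mod d (edgeSum-rot i j t))
        (≡-mod-trans (≡⇒≡-mod (xy∙z≈xz∙y (i + j) (t + t) d))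
          (≡-mod-trans (+-congʳ-mod (t + t) gap) (≡-mod-sym (edgeSum-rot i′ j′ t)))))

  reflect-below : ∀ i → m ∸ i < n
  reflect-below i = s≤s (m∸n≤m m i)

  edgeSum-rev : ∀ {i j} → EdgeBelow n (i , j) → edgeSum (mkEdge (m ∸ i) (m ∸ j)) + edgeSum (i , j) ≡ m + m
  edgeSum-rev {i} {j} (i<n , j<n) = begin
    edgeSum (mkEdge (m ∸ i) (m ∸ j)) + (i + j)  ≡⟨ cong (_+ (i + j)) (edgeSum-mkEdge (m ∸ i) (m ∸ j)) ⟩
    (m ∸ i) + (m ∸ j) + (i + j)                 ≡⟨ interchange (m ∸ i) (m ∸ j) i j ⟩
    (m ∸ i + i) + (m ∸ j + j)                   ≡⟨ cong₂ _+_ (m∸n+n≡m (s≤s⁻¹ i<n)) (m∸n+n≡m (s≤s⁻¹ j<n)) ⟩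
    m + m                                       ∎
    where open ≡-Reasoning

  SumGap-rev : ∀ {d} M → SumGap n d M → SumGap n d (rev n M)
  SumGap-rev M (sumGap {i , j} {i′ , j′} e∈M f∈M e<n f<n gap) =
    sumGap (∈-map⁺ _ f∈M) (∈-map⁺ _ e∈M)
      (mkEdge-below (reflect-below i′) (reflect-below j′)) (mkEdge-below (reflect-below i) (reflect-below j))
      (≡-mod-reflect gap (edgeSum-rev e<n) (edgeSum-rev f<n))

  edgeSum-kirkman : ∀ {e} → e ∈ kirkman n → edgeSum e ≡ m
  edgeSum-kirkman e∈K with ∈-map⁻ _ e∈K
  ... | i , i<n/2 , refl = trans (edgeSum-mkEdge i (m ∸ i)) (m+[n∸m]≡n i≤m)
    where
    i≤m : i ≤ m
    i≤m = s≤s⁻¹ (≤-trans (∈-upTo⁻ i<n/2) (m/n≤m n 2))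

  SumGap-kirkman : ∀ {d M} → d < n → SameMatching M (kirkman n) → SumGap n d M → d ≡ 0
  SumGap-kirkman {d} d<n M≈K (sumGap {e} {f} e∈M f∈M _ _ gap) =
    ≡-mod-0⇒≡0 (+-cancelʳ-mod m (subst₂ (λ u v → u ≡ v mod n) sum-e+d sum-f gap)) d<n
    where
    sum-e+d : edgeSum e + d ≡ d + m
    sum-e+d = trans (cong (_+ d) (edgeSum-kirkman (Equivalence.to (M≈K e) e∈M))) (+-comm m d)
    sum-f : edgeSum f ≡ m
    sum-f = edgeSum-kirkman (Equivalence.to (M≈K f) f∈M)

module _ (n : ℕ) (P : Matching → Set)
         (P-rot : ∀ M t → P M → P (rot n M t)) (P-rev : ∀ M → P M → P (rev n M)) where

  normStep1-preserves : ∀ M → P M → P (normStep1 n M)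
  normStep1-preserves M PM with findColour n 1 M
  ... | nothing = PM
  ... | just (i , j) with (i ≡ᵇ 0) ∧ (j ≡ᵇ (n ∸ 1))
  ...   | true  = PM
  ...   | false = P-rot M (n ∸ j) PM

  normLoop-preserves : ∀ k cnt M → P M → P (normLoop n k cnt M)
  normLoop-preserves k zero      M PM = PM
  normLoop-preserves k (suc cnt) M PM with findColour n k M
  ... | nothing = normLoop-preserves (suc k) cnt M PM
  ... | just (i , j) with (i + j) <ᵇ (n ∸ 1)
  ...   | true = PM
  ...   | false with (n ∸ 1) <ᵇ (i + j)
  ...     | true  = P-rev M PM
  ...     | false = normLoop-preserves (suc k) cnt M PM

  norm-preserves : ∀ M → P M → P (norm n M)
  norm-preserves M PM = normLoop-preserves 2 (n / 2 ∸ 1) (normStep1 n M) (normStep1-preserves M PM)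

≤-offset : ∀ {x y} c → x + c ≡ y → x ≤ y
≤-offset {x} c refl = m≤m+n x c

sumGap-progression : ∀ {n} A B L → A + 1 < n → B + 2 < n → 2 ≤ L →
                     SumGap n 3 (map (λ i → mkEdge (A + i) (B + 2 * i)) (upTo L))
sumGap-progression {n} A B L A+1<n B+2<n 2≤L =
  sumGap (∈-map⁺ _ (∈-upTo⁺ {i = 0} (≤-trans (s≤s z≤n) 2≤L))) (∈-map⁺ _ (∈-upTo⁺ {i = 1} 2≤L))
    (mkEdge-below (≤-<-trans (+-monoʳ-≤ A z≤n) A+1<n) (≤-<-trans (+-monoʳ-≤ B z≤n) B+2<n))
    (mkEdge-below A+1<n B+2<n)
    (≡⇒≡-mod (begin
      edgeSum (mkEdge (A + 0) (B + 0)) + 3  ≡⟨ cong (_+ 3) (edgeSum-mkEdge (A + 0) (B + 0)) ⟩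
      A + 0 + (B + 0) + 3                   ≡⟨ sums-differ-by-3 A B ⟩
      A + 1 + (B + 2)                       ≡⟨ edgeSum-mkEdge (A + 1) (B + 2) ⟨
      edgeSum (mkEdge (A + 1) (B + 2))      ∎))
  where
  open ≡-Reasoning
  sums-differ-by-3 : ∀ A B → A + 0 + (B + 0) + 3 ≡ A + 1 + (B + 2)
  sums-differ-by-3 = solve-∀

sumGap-Xi″ : ∀ k r → r % 2 ≡ 1 → r < 8 → 7 ≤ r + k * 8 → SumGap (r + k * 8) 3 (Xi″ k r)
sumGap-Xi″ zero    1 _ _ (s≤s ())
sumGap-Xi″ (suc k) 1 _ _ _ = sumGap-progression (2 * suc k) (4 * suc k + 1) (2 * suc k)
  (≤-offset (6 * k + 5) (solve (k ∷ []))) (≤-offset (4 * k + 1) (solve (k ∷ []))) (≤-offset (2 * k) (solve (k ∷ [])))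
sumGap-Xi″ zero    3 _ _ (s≤s (s≤s (s≤s ())))
sumGap-Xi″ (suc k) 3 _ _ _ = sumGap-progression (2 * suc k) (4 * suc k + 1) (2 * suc k + 1)
  (≤-offset (6 * k + 7) (solve (k ∷ []))) (≤-offset (4 * k + 3) (solve (k ∷ []))) (≤-offset (2 * k + 1) (solve (k ∷ [])))
sumGap-Xi″ zero    5 _ _ (s≤s (s≤s (s≤s (s≤s (s≤s ())))))
sumGap-Xi″ (suc k) 5 _ _ _ = sumGap-progression (2 * suc k + 2) (4 * suc k + 4) (2 * suc k + 1)
  (≤-offset (6 * k + 7) (solve (k ∷ []))) (≤-offset (4 * k + 2) (solve (k ∷ []))) (≤-offset (2 * k + 1) (solve (k ∷ [])))
sumGap-Xi″ k       7 _ _ _ = sumGap-progression (2 * k + 2) (4 * k + 4) (2 * k + 2)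
  (≤-offset (6 * k + 3) (solve (k ∷ []))) (≤-offset (4 * k) (solve (k ∷ []))) (≤-offset (2 * k) (solve (k ∷ [])))
sumGap-Xi″ k 0 () _ _
sumGap-Xi″ k 2 () _ _
sumGap-Xi″ k 4 () _ _
sumGap-Xi″ k 6 () _ _
sumGap-Xi″ k (suc (suc (suc (suc (suc (suc (suc (suc r)))))))) _ (s≤s (s≤s (s≤s (s≤s (s≤s (s≤s (s≤s (s≤s ())))))))) _

sumGap-Xi : ∀ n → 7 ≤ n → n % 2 ≡ 1 → SumGap n 3 (Xi n)
sumGap-Xi n@(suc (suc _)) 7≤n n-odd =
  SumGap-mono (∈-++⁺ʳ (Xi′ k r) ∘ ∈-++⁺ˡ)
    (subst (λ n′ → SumGap n′ 3 (Xi″ k r)) (sym n≡r+k*8)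
      (sumGap-Xi″ k r r-odd (m%n<n n 8) (subst (7 ≤_) n≡r+k*8 7≤n)))
  where
  k r : ℕ
  k = n / 8
  r = n % 8
  n≡r+k*8 : n ≡ r + k * 8
  n≡r+k*8 = m≡m%n+[m/n]*n n 8
  r-odd : r % 2 ≡ 1
  r-odd = trans (m∣n⇒o%n%m≡o%m 2 8 n (divides 4 refl)) n-odd
sumGap-Xi 0 () _
sumGap-Xi 1 (s≤s ()) _

mainTheorem4 : (n : ℕ) → 7 ≤ n → n % 2 ≡ 1 → ¬ SameMatching (norm n (Xi n)) (kirkman n)
mainTheorem4 0 () _
mainTheorem4 (suc m) 7≤n n-odd norm-Xi≈K = 3≢0 (SumGap-kirkman m 3<n norm-Xi≈K sumGap-norm-Xi)
  where
  3≢0 : ¬ 3 ≡ 0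
  3≢0 ()
  3<n : 3 < suc m
  3<n = ≤-trans (s≤s (s≤s (s≤s (s≤s z≤n)))) 7≤n
  sumGap-norm-Xi : SumGap (suc m) 3 (norm (suc m) (Xi (suc m)))
  sumGap-norm-Xi = norm-preserves (suc m) (SumGap (suc m) 3) (SumGap-rot m) (SumGap-rev m) (Xi (suc m))
                     (sumGap-Xi (suc m) 7≤n n-odd)
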